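{- Let $M$ be a matroid with ground set $\mathcal{A}$, $n=|\mathcal{A}|$. For $e=(a_1,\dots,a_n,b_1,\dots,b_n)\in EC(M)$ let $c_e$ be the coefficient of the monomial $u_1^{a_1}\cdots u_n^{a_n}v_1^{b_1}\cdots v_n^{b_n}$ in $W^n_M((u_i)_1^n;(v_i)_1^n)$. Then $$\mathcal{G}(M)=\sum_{e\in EC(M)}c_e\,U_{(\mathrm{rk}(M)-a_1,\ a_1-a_2,\ \dots,\ a_{n-1}-a_n)}.$$
   Context: For a matroid $M$ on ground set $\mathcal{A}$ with rank function $\mathrm{rk}$, $W^n_M((u_i)_1^n;(v_i)_1^n)=\sum_{S_1\subseteq\cdots\subseteq S_n\subseteq\mathcal{A}}\prod_{i=1}^n u_i^{\mathrm{rk}(\mathcal{A})-\mathrm{rk}(S_i)}v_i^{|S_i|-\mathrm{rk}(S_i)}$ (sum over weakly increasing chains of $n$ subsets). An exponent complete chain for $M$ is a sequence of nonnegative integers $(a_1,\dots,a_n,b_1,\dots,b_n)$ with $a_i-b_i=\mathrm{rk}(M)-i$ for all $i\in\{1,\dots,n\}$; $EC(M)$ is the set of these. A complete chain is $\bar X=(X_0,\dots,X_n)$ with $\emptyset=X_0\subset X_1\subset\cdots\subset X_n=\mathcal{A}$; its rank vector is $r(\bar X)=(\mathrm{rk}(X_1)-\mathrm{rk}(X_0),\dots,\mathrm{rk}(X_n)-\mathrm{rk}(X_{n-1}))$. With $\{U_r\}$ linearly independent formal symbols (a basis of quasi-symmetric functions) indexed by finite sequences of nonnegative integers, Derksen's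 invariant is $\mathcal{G}(M)=\sum_{\bar X}U_{r(\bar X)}$ over all complete chains. -}

module Defs where

open import Data.Nat using (ℕ; zero; suc; _+_; _≤_; _≤?_)
open import Data.Nat.Properties using () renaming (_≟_ to _≟ℕ_)
open import Data.Integer using (ℤ; +_; _-_) renaming (_≟_ to _≟ℤ_)
open import Data.Fin using (Fin; toℕ; inject₁; fromℕ) renaming (zero to fzero; suc to fsuc)
open import Data.Fin.Properties using (all?)
open import Data.Fin.Subset using (Subset; ⊤; ⊥; _⊆_; _⊂_; _∪_; _∩_; ∣_∣; inside; outside)
open import Data.Fin.Subset.Properties using (_⊆?_; _⊂?_)
open import Data.Vec using (Vec; []; _∷_; lookup; tabulate)
open import Data.Vec.Properties using (≡-dec)
open import Data.Bool.Properties using () renaming (_≟_ to _≟B_)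
open import Data.List using (List; []; _∷_; [_]; map; concatMap; filter; length)
open import Data.Nat.ListAction using (sum)
open import Data.List.Relation.Unary.All using (All)
open import Data.List.Relation.Unary.Unique.Propositional using (Unique)
open import Data.List.Membership.Propositional using (_∈_)
open import Data.Product using (Σ; _×_; _,_)
open import Relation.Nullary using (Dec; ¬_)
open import Relation.Nullary.Decidable using (_×-dec_; _→-dec_)
open import Relation.Binary.PropositionalEquality using (_≡_)

record Matroid (n : ℕ) : Set where
  field
    rk        : Subset n → ℕ
    rk-card   : ∀ X → rk X ≤ ∣ X ∣
    rk-mono   : ∀ {X Y} → X ⊆ Y → rk X ≤ rk Y
    rk-submod : ∀ X Y → rk (X ∪ Y) + rk (X ∩ Y) ≤ rk X + rk Y

allSubsets : (m : ℕ) → List (Subset m)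
allSubsets zero    = [ [] ]
allSubsets (suc m) = concatMap (λ s → (outside ∷ s) ∷ (inside ∷ s) ∷ []) (allSubsets m)

allVecs : {A : Set} → List A → (k : ℕ) → List (Vec A k)
allVecs xs zero    = [ [] ]
allVecs xs (suc k) = concatMap (λ x → map (x ∷_) (allVecs xs k)) xs

module _ {n : ℕ} (M : Matroid n) where
  open Matroid M

  rkM : ℕ
  rkM = rk ⊤

  -- The polynomial W^n_M and its coefficients.
  -- S : Vec (Subset n) n ; lookup S i is S_{i+1}.
  IsWeakChain : Vec (Subset n) n → Set
  IsWeakChain S = ∀ (i j : Fin n) → toℕ i ≤ toℕ j → lookup S i ⊆ lookup S j

  isWeakChain? : ∀ S → Dec (IsWeakChain S)
  isWeakChain? S = all? λ i → all? λ j → (toℕ i ≤? toℕ j) →-dec (lookup S i ⊆? lookup S j)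

  -- the term of chain S is the monomial u^a v^b, i.e. for all i:
  -- a_i = rk(A) - rk(S_i) and b_i = |S_i| - rk(S_i)
  HasMonomial : Vec ℕ n → Vec ℕ n → Vec (Subset n) n → Set
  HasMonomial a b S = ∀ (i : Fin n) →
    (rk ⊤ ≡ lookup a i + rk (lookup S i)) × (∣ lookup S i ∣ ≡ lookup b i + rk (lookup S i))

  hasMonomial? : ∀ a b S → Dec (HasMonomial a b S)
  hasMonomial? a b S = all? λ i →
    (rk ⊤ ≟ℕ lookup a i + rk (lookup S i)) ×-dec (∣ lookup S i ∣ ≟ℕ lookup b i + rk (lookup S i))

  -- coefficient of u_1^{a_1}..u_n^{a_n} v_1^{b_1}..v_n^{b_n} in W^n_M
  -- = number of weakly increasing chains S_1 ⊆ ... ⊆ S_n whose term is that monomial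
  coeffW : Vec ℕ n → Vec ℕ n → ℕ
  coeffW a b = length (filter (λ S → isWeakChain? S ×-dec hasMonomial? a b S)
                              (allVecs (allSubsets n) n))

  InEC : Vec ℕ n × Vec ℕ n → Set
  InEC (a , b) = ∀ (i : Fin n) → (+ lookup a i) - (+ lookup b i) ≡ (+ rkM) - (+ suc (toℕ i))

  c : Vec ℕ n × Vec ℕ n → ℕ
  c (a , b) = coeffW a b

  diffs : {k : ℕ} → ℤ → Vec ℕ k → Vec ℤ k
  diffs p []       = []
  diffs p (x ∷ xs) = (p - (+ x)) ∷ diffs (+ x) xs

  idx : Vec ℕ n × Vec ℕ n → Vec ℤ n
  idx (a , b) = diffs (+ rkM) a

  IsCompleteChain : Vec (Subset n) (suc n) → Set
  IsCompleteChain X = (lookup X fzero ≡ ⊥) × (lookup X (fromℕ n) ≡ ⊤)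
                      × (∀ (i : Fin n) → lookup X (inject₁ i) ⊂ lookup X (fsuc i))

  isCompleteChain? : ∀ X → Dec (IsCompleteChain X)
  isCompleteChain? X = ≡-dec _≟B_ (lookup X fzero) ⊥ ×-dec (≡-dec _≟B_ (lookup X (fromℕ n)) ⊤
                       ×-dec all? (λ i → lookup X (inject₁ i) ⊂? lookup X (fsuc i)))

  rankVec : Vec (Subset n) (suc n) → Vec ℤ n
  rankVec X = tabulate λ i → (+ rk (lookup X (fsuc i))) - (+ rk (lookup X (inject₁ i)))

  -- coefficient of U_r in Derksen's invariant G(M) = Σ_X U_{r(X)}
  coeffG : Vec ℤ n → ℕ
  coeffG r = length (filter (λ X → isCompleteChain? X ×-dec ≡-dec _≟ℤ_ (rankVec X) r)
                            (allVecs (allSubsets n) (suc n)))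

-- `coef` is the coefficient function of the formal (locally finite) sum
-- Σ_{e ∈ E, P e} w e · U_{f e}: for each index r, the fiber
-- {e | P e, f e = r, w e ≠ 0} is listed without repetition by some list L
-- (all of whose members are in the fiber), and coef r is the sum of w over L.
IsFormalSumCoeff : {E I : Set} → (I → ℕ) → (E → Set) → (E → ℕ) → (E → I) → Set
IsFormalSumCoeff {E} {I} coef P w f =
  ∀ (r : I) → Σ (List E) λ L →
    Unique L × All (λ e → P e × (f e ≡ r)) L
    × (∀ e → P e → f e ≡ r → ¬ (w e ≡ 0) → e ∈ L)
    × (coef r ≡ sum (map w L))

-- A weak chain S₁ ⊆ ⋯ ⊆ Sₙ contributes the monomial with exponents
-- aᵢ = rk M − rk Sᵢ and bᵢ = |Sᵢ| − rk Sᵢ, so aᵢ − bᵢ = rk M − |Sᵢ|. Hence its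
-- exponent lies in EC(M) exactly when |Sᵢ| = i, i.e. when ∅ ⊂ S₁ ⊂ ⋯ ⊂ Sₙ is a
-- complete chain, and then the rank vector of that chain telescopes to
-- (rk M − a₁, a₁ − a₂, …, aₙ₋₁ − aₙ). So c_e counts the complete chains with
-- rank vector idx e. Since idx is injective on EC(M) (a is recovered from the
-- differences, and b from a), each coefficient of 𝒢(M) is a single c_e, or 0.
module Submission where

open import Defs
open import Level using (0ℓ)
open import Function using (_∘_; _⇔_; mk⇔; Equivalence)
open import Data.Nat using (ℕ; zero; suc; _+_; _≤_; _<_; z≤n; s≤s; _∸_)
import Data.Nat.Properties as ℕ
open import Data.Integer as ℤ using (ℤ; +_; _-_)
import Data.Integer.Properties as ℤ
open import Data.Integer.Tactic.RingSolver using (solve-∀)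
open import Data.Fin using (Fin; toℕ; inject₁; fromℕ) renaming (zero to fzero; suc to fsuc)
import Data.Fin.Properties as Fin
open import Data.Fin.Subset using (Subset; ⊤; ⊥; _⊆_; _⊂_; ∣_∣; inside; outside)
import Data.Fin.Subset.Properties as Subset
open import Data.Vec using (Vec; []; _∷_; lookup; tabulate)
import Data.Vec.Properties as Vec
open import Data.List using (List; []; _∷_; [_]; _++_; map; concatMap; filter; length)
import Data.List.Properties as List
open import Data.Nat.ListAction using (sum)
import Data.Nat.ListAction.Properties as ListAction
open import Data.List.Relation.Unary.All using ([]; _∷_; universal)
open import Data.List.Relation.Unary.AllPairs using ([]; _∷_)
open import Data.List.Relation.Unary.Any using (here; satisfied; any?)
open import Data.List.Relation.Unary.All.Properties using (¬Any⇒All¬)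
open import Data.Product using (Σ; _×_; _,_; proj₁; proj₂)
open import Data.Sum using (_⊎_; inj₁; inj₂)
open import Data.Empty using (⊥-elim)
open import Relation.Nullary using (yes; no)
open import Relation.Nullary.Decidable using (_×-dec_; ¬?)
open import Relation.Unary using (Pred; Decidable; _≐_)
open import Relation.Binary.PropositionalEquality hiding ([_])

open Equivalence using (to; from)

module _ {A : Set} {P : Pred A 0ℓ} (P? : Decidable P) where

  length-filter-map : ∀ {B : Set} (h : B → A) ys →
    length (filter P? (map h ys)) ≡ length (filter (P? ∘ h) ys)
  length-filter-map h [] = refl
  length-filter-map h (y ∷ ys) with P? (h y)
  ... | yes _ = cong suc (length-filter-map h ys)
  ... | no _  = length-filter-map h ys

  length-filter-concatMap : ∀ {B : Set} (g : B → List A) xs →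
    length (filter P? (concatMap g xs)) ≡ sum (map (length ∘ filter P? ∘ g) xs)
  length-filter-concatMap g [] = refl
  length-filter-concatMap g (x ∷ xs) = begin
    length (filter P? (g x ++ concatMap g xs))
      ≡⟨ cong length (List.filter-++ P? (g x) (concatMap g xs)) ⟩
    length (filter P? (g x) ++ filter P? (concatMap g xs))
      ≡⟨ List.length-++ (filter P? (g x)) ⟩
    length (filter P? (g x)) + length (filter P? (concatMap g xs))
      ≡⟨ cong (λ s → length (filter P? (g x)) + s) (length-filter-concatMap g xs) ⟩
    length (filter P? (g x)) + sum (map (length ∘ filter P? ∘ g) xs) ∎
    where open ≡-Reasoning

sum-map-concatMap : ∀ {A B : Set} (f : A → ℕ) (g : B → List A) xs →
  sum (map f (concatMap g xs)) ≡ sum (map (sum ∘ map f ∘ g) xs)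
sum-map-concatMap f g [] = refl
sum-map-concatMap f g (x ∷ xs) = begin
  sum (map f (g x ++ concatMap g xs))
    ≡⟨ cong sum (List.map-++ f (g x) _) ⟩
  sum (map f (g x) ++ map f (concatMap g xs))
    ≡⟨ ListAction.sum-++ (map f (g x)) _ ⟩
  sum (map f (g x)) + sum (map f (concatMap g xs))
    ≡⟨ cong (λ s → sum (map f (g x)) + s) (sum-map-concatMap f g xs) ⟩
  sum (map f (g x)) + sum (map (sum ∘ map f ∘ g) xs) ∎
  where open ≡-Reasoning

-- ⊥ is listed exactly once by allSubsets.
sum-allSubsets-supported-at-⊥ : ∀ m (f : Subset m → ℕ) → (∀ x → x ≢ ⊥ → f x ≡ 0) →
  sum (map f (allSubsets m)) ≡ f ⊥
sum-allSubsets-supported-at-⊥ zero f _ = ℕ.+-identityʳ (f [])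
sum-allSubsets-supported-at-⊥ (suc m) f f≡0 = begin
  sum (map f (allSubsets (suc m)))
    ≡⟨ sum-map-concatMap f (λ s → (outside ∷ s) ∷ (inside ∷ s) ∷ []) (allSubsets m) ⟩
  sum (map (λ s → f (outside ∷ s) + (f (inside ∷ s) + 0)) (allSubsets m))
    ≡⟨ cong sum (List.map-cong inside-vanishes (allSubsets m)) ⟩
  sum (map (λ s → f (outside ∷ s)) (allSubsets m))
    ≡⟨ sum-allSubsets-supported-at-⊥ m (f ∘ (outside ∷_))
                                      (λ s s≢⊥ → f≡0 _ (s≢⊥ ∘ Vec.∷-injectiveʳ)) ⟩
  f ⊥ ∎
  where
  open ≡-Reasoning
  inside-vanishes : ∀ s → f (outside ∷ s) + (f (inside ∷ s) + 0) ≡ f (outside ∷ s)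
  inside-vanishes s rewrite f≡0 (inside ∷ s) (λ ()) = ℕ.+-identityʳ _

count-⊥-headed : ∀ {m k} {P : Pred (Vec (Subset m) (suc k)) 0ℓ} (P? : Decidable P) →
  (∀ {X} → P X → lookup X fzero ≡ ⊥) →
  length (filter P? (allVecs (allSubsets m) (suc k)))
    ≡ length (filter (P? ∘ (⊥ ∷_)) (allVecs (allSubsets m) k))
count-⊥-headed {m} {k} P? head≡⊥ = begin
  length (filter P? (concatMap (λ x → map (x ∷_) Vs) (allSubsets m)))
    ≡⟨ length-filter-concatMap P? _ (allSubsets m) ⟩
  sum (map (λ x → length (filter P? (map (x ∷_) Vs))) (allSubsets m))
    ≡⟨ cong sum (List.map-cong (λ x → length-filter-map P? (x ∷_) Vs) (allSubsets m)) ⟩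
  sum (map (λ x → length (filter (P? ∘ (x ∷_)) Vs)) (allSubsets m))
    ≡⟨ sum-allSubsets-supported-at-⊥ m _ other-heads-vanish ⟩
  length (filter (P? ∘ (⊥ ∷_)) Vs) ∎
  where
  open ≡-Reasoning
  Vs : List (Vec (Subset m) k)
  Vs = allVecs (allSubsets m) k
  other-heads-vanish : ∀ x → x ≢ ⊥ → length (filter (P? ∘ (x ∷_)) Vs) ≡ 0
  other-heads-vanish x x≢⊥ =
    cong length (List.filter-none (P? ∘ (x ∷_)) (universal (λ _ → x≢⊥ ∘ head≡⊥) Vs))

strictMono⇒lowerBound : ∀ m (g : Fin (suc m) → ℕ) → (∀ i → g (inject₁ i) < g (fsuc i)) →
  ∀ j → g fzero + toℕ j ≤ g j
strictMono⇒lowerBound m g g< fzero = ℕ.≤-reflexive (ℕ.+-identityʳ _)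
strictMono⇒lowerBound (suc m) g g< (fsuc j) = begin
  g fzero + suc (toℕ j)    ≡⟨ ℕ.+-suc (g fzero) (toℕ j) ⟩
  suc (g fzero) + toℕ j    ≤⟨ ℕ.+-monoˡ-≤ (toℕ j) (g< fzero) ⟩
  g (fsuc fzero) + toℕ j   ≤⟨ strictMono⇒lowerBound m (g ∘ fsuc) (g< ∘ fsuc) j ⟩
  g (fsuc j)               ∎
  where open ℕ.≤-Reasoning

strictMono⇒upperBound : ∀ m (g : Fin (suc m) → ℕ) → (∀ i → g (inject₁ i) < g (fsuc i)) →
  ∀ j → g j + (m ∸ toℕ j) ≤ g (fromℕ m)
strictMono⇒upperBound zero g g< fzero = ℕ.≤-reflexive (ℕ.+-identityʳ _)
strictMono⇒upperBound (suc m) g g< fzero = begin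
  g fzero + suc m          ≡⟨ ℕ.+-suc (g fzero) m ⟩
  suc (g fzero) + m        ≤⟨ ℕ.+-monoˡ-≤ m (g< fzero) ⟩
  g (fsuc fzero) + m       ≤⟨ strictMono⇒upperBound m (g ∘ fsuc) (g< ∘ fsuc) fzero ⟩
  g (fromℕ (suc m))        ∎
  where open ℕ.≤-Reasoning
strictMono⇒upperBound (suc m) g g< (fsuc j) = strictMono⇒upperBound m (g ∘ fsuc) (g< ∘ fsuc) j

strictMono-0-to-m⇒toℕ : ∀ m (g : Fin (suc m) → ℕ) → (∀ i → g (inject₁ i) < g (fsuc i)) →
  g fzero ≡ 0 → g (fromℕ m) ≡ m → ∀ j → g j ≡ toℕ j
strictMono-0-to-m⇒toℕ m g g< g₀≡0 gₘ≡m j = ℕ.≤-antisym g≤j j≤g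
  where
  j≤m : toℕ j ≤ m
  j≤m = ℕ.≤-pred (Fin.toℕ<n j)
  j≤g : toℕ j ≤ g j
  j≤g = subst (λ g₀ → g₀ + toℕ j ≤ g j) g₀≡0 (strictMono⇒lowerBound m g g< j)
  g≤j : g j ≤ toℕ j
  g≤j = ℕ.+-cancelʳ-≤ (m ∸ toℕ j) (g j) (toℕ j)
    (subst₂ _≤_ refl (trans gₘ≡m (sym (ℕ.m+[n∸m]≡n j≤m))) (strictMono⇒upperBound m g g< j))

stepwise⊆⇒mono : ∀ {k} m (X : Fin (suc m) → Subset k) → (∀ i → X (inject₁ i) ⊆ X (fsuc i)) →
  ∀ i j → toℕ i ≤ toℕ j → X i ⊆ X j
stepwise⊆⇒mono m X X⊆ fzero fzero _ = Subset.⊆-refl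
stepwise⊆⇒mono (suc m) X X⊆ fzero (fsuc j) _ =
  Subset.⊆-trans (X⊆ fzero) (stepwise⊆⇒mono m (X ∘ fsuc) (X⊆ ∘ fsuc) fzero j z≤n)
stepwise⊆⇒mono (suc m) X X⊆ (fsuc i) (fsuc j) (s≤s i≤j) =
  stepwise⊆⇒mono m (X ∘ fsuc) (X⊆ ∘ fsuc) i j i≤j

p⊆q∧∣p∣<∣q∣⇒p⊂q : ∀ {k} {p q : Subset k} → p ⊆ q → ∣ p ∣ < ∣ q ∣ → p ⊂ q
p⊆q∧∣p∣<∣q∣⇒p⊂q {k} {p} {q} p⊆q ∣p∣<∣q∣
  with Fin.any? (λ x → (x Subset.∈? q) ×-dec ¬? (x Subset.∈? p))
... | yes (x , x∈q , x∉p) = p⊆q , x , x∈q , x∉p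
... | no q⊈p = ⊥-elim (ℕ.<⇒≱ ∣p∣<∣q∣ (Subset.p⊆q⇒∣p∣≤∣q∣ q⊆p))
  where
  q⊆p : q ⊆ p
  q⊆p {x} x∈q with x Subset.∈? p
  ... | yes x∈p = x∈p
  ... | no x∉p  = ⊥-elim (q⊈p (x , x∈q , x∉p))

m≡n+o⇔+n≡+m-+o : ∀ m n o → m ≡ n + o ⇔ + n ≡ + m - + o
m≡n+o⇔+n≡+m-+o m n o = mk⇔
  (λ m≡n+o → trans (sym (add-sub (+ n) (+ o)))
                   (cong (_- + o) (trans (sym (ℤ.pos-+ n o)) (cong +_ (sym m≡n+o)))))
  (λ n≡m-o → ℤ.+-injective (trans (sym (sub-add (+ m) (+ o)))
                                 (trans (cong (ℤ._+ + o) (sym n≡m-o)) (sym (ℤ.pos-+ n o)))))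
  where
  add-sub : ∀ x y → x ℤ.+ y - y ≡ x
  add-sub = solve-∀
  sub-add : ∀ x y → x - y ℤ.+ y ≡ x
  sub-add = solve-∀

sub-sub-cancelʳ : ∀ {A B : ℤ} R C K → A ≡ R - K → B ≡ C - K → A - B ≡ R - C
sub-sub-cancelʳ R C K refl refl = identity R C K
  where
  identity : ∀ R C K → (R - K) - (C - K) ≡ R - C
  identity = solve-∀

sub-sub-cancelʳ⁻¹ : ∀ {A B : ℤ} R C K → A ≡ R - K → A - B ≡ R - C → B ≡ C - K
sub-sub-cancelʳ⁻¹ {A} {B} R C K refl A-B≡R-C = begin
  B                     ≡⟨ identity B R K ⟩
  (R - K) - ((R - K) - B) ≡⟨ cong ((R - K) -_) A-B≡R-C ⟩
  (R - K) - (R - C)     ≡⟨ identity′ R C K ⟩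
  C - K                 ∎
  where
  open ≡-Reasoning
  identity : ∀ B R K → B ≡ (R - K) - ((R - K) - B)
  identity = solve-∀
  identity′ : ∀ R C K → (R - K) - (R - C) ≡ C - K
  identity′ = solve-∀

sub-injectiveʳ : ∀ R {x y : ℤ} → R - x ≡ R - y → x ≡ y
sub-injectiveʳ R {x} {y} R-x≡R-y = begin
  x             ≡⟨ identity R x ⟩
  R - (R - x)   ≡⟨ cong (R -_) R-x≡R-y ⟩
  R - (R - y)   ≡⟨ identity R y ⟨
  y             ∎
  where
  open ≡-Reasoning
  identity : ∀ R x → x ≡ R - (R - x)
  identity = solve-∀

-- Read with m = rk M, k = rk Sᵢ, c = |Sᵢ| and t = i: for an exponent in EC(M), the
-- monomial condition of a chain at i is the condition on aᵢ alone plus |Sᵢ| = i.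
exponents⇔ : ∀ {m a b k c t : ℕ} → + a - + b ≡ + m - + t →
  (m ≡ a + k × c ≡ b + k) ⇔ (+ a ≡ + m - + k × c ≡ t)
exponents⇔ {m} {a} {b} {k} {c} {t} a-b≡m-t = mk⇔
  (λ (m≡a+k , c≡b+k) → let a≡m-k = to (m≡n+o⇔+n≡+m-+o m a k) m≡a+k in
     a≡m-k , trans c≡b+k (sym (t≡b+k a≡m-k)))
  (λ (a≡m-k , c≡t) → from (m≡n+o⇔+n≡+m-+o m a k) a≡m-k , trans c≡t (t≡b+k a≡m-k))
  where
  t≡b+k : + a ≡ + m - + k → t ≡ b + k
  t≡b+k a≡m-k =
    from (m≡n+o⇔+n≡+m-+o t b k) (sub-sub-cancelʳ⁻¹ (+ m) (+ t) (+ k) a≡m-k a-b≡m-t)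

m≡a+k∧c≡b+k⇒a-b≡m-c : ∀ {m k c : ℕ} a b → m ≡ a + k → c ≡ b + k → + a - + b ≡ + m - + c
m≡a+k∧c≡b+k⇒a-b≡m-c {m} {k} {c} a b m≡a+k c≡b+k =
  sub-sub-cancelʳ (+ m) (+ c) (+ k) (to (m≡n+o⇔+n≡+m-+o m a k) m≡a+k)
                                    (to (m≡n+o⇔+n≡+m-+o c b k) c≡b+k)

lookup-extensionality : ∀ {A : Set} {k} {u v : Vec A k} → (∀ i → lookup u i ≡ lookup v i) → u ≡ v
lookup-extensionality {u = u} {v} u≗v =
  trans (sym (Vec.tabulate∘lookup u)) (trans (Vec.tabulate-cong u≗v) (Vec.tabulate∘lookup v))

module _ {n : ℕ} (M : Matroid n) where
  open Matroid M

  telescope : ∀ {k} (c p : ℤ) (a : Vec ℕ k) (h : Fin (suc k) → ℤ) → p ≡ c - h fzero →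
    (∀ i → + lookup a i ≡ c - h (fsuc i)) →
    tabulate (λ i → h (fsuc i) - h (inject₁ i)) ≡ diffs M p a
  telescope c p [] h _ _ = refl
  telescope c p (x ∷ xs) h refl a≡c-h =
    cong₂ _∷_ (trans (identity c (h fzero) (h (fsuc fzero)))
                     (cong ((c - h fzero) -_) (sym (a≡c-h fzero))))
              (telescope c (+ x) xs (h ∘ fsuc) (a≡c-h fzero) (a≡c-h ∘ fsuc))
    where
    identity : ∀ c h₀ h₁ → h₁ - h₀ ≡ (c - h₀) - (c - h₁)
    identity = solve-∀

  untelescope : ∀ {k} (c p : ℤ) (a : Vec ℕ k) (h : Fin (suc k) → ℤ) → p ≡ c - h fzero →
    tabulate (λ i → h (fsuc i) - h (inject₁ i)) ≡ diffs M p a →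
    ∀ i → + lookup a i ≡ c - h (fsuc i)
  untelescope c p (x ∷ xs) h refl eq fzero =
    trans (identity c (h fzero) (+ x))
          (trans (cong ((c - h fzero) -_) (sym (Vec.∷-injectiveˡ eq)))
                 (identity′ c (h fzero) (h (fsuc fzero))))
    where
    identity : ∀ c h₀ x → x ≡ (c - h₀) - ((c - h₀) - x)
    identity = solve-∀
    identity′ : ∀ c h₀ h₁ → (c - h₀) - (h₁ - h₀) ≡ c - h₁
    identity′ = solve-∀
  untelescope c p (x ∷ xs) h refl eq (fsuc i) =
    untelescope c (+ x) xs (h ∘ fsuc) (untelescope c p (x ∷ xs) h refl eq fzero)
                (Vec.∷-injectiveʳ eq) i

  diffs-injective : ∀ {k} p (a a′ : Vec ℕ k) → diffs M p a ≡ diffs M p a′ → a ≡ a′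
  diffs-injective p [] [] _ = refl
  diffs-injective p (x ∷ xs) (y ∷ ys) eq
    with ℤ.+-injective {x} {y} (sub-injectiveʳ p (Vec.∷-injectiveˡ eq))
  ... | refl = cong (x ∷_) (diffs-injective (+ x) xs ys (Vec.∷-injectiveʳ eq))

  idx-injective : ∀ e e′ → InEC M e → InEC M e′ → idx M e ≡ idx M e′ → e ≡ e′
  idx-injective (a , b) (a′ , b′) e∈EC e′∈EC idx≡idx with diffs-injective _ a a′ idx≡idx
  ... | refl = cong (a ,_) (lookup-extensionality λ i →
                 ℤ.+-injective (sub-injectiveʳ (+ lookup a i) (trans (e∈EC i) (sym (e′∈EC i)))))

  rk-⊥ : rk ⊥ ≡ 0
  rk-⊥ = ℕ.n≤0⇒n≡0 (subst (rk ⊥ ≤_) (Subset.∣⊥∣≡0 n) (rk-card ⊥))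

  rankVec≡idx⇔ : ∀ S a b →
    rankVec M (⊥ ∷ S) ≡ idx M (a , b) ⇔ (∀ i → + lookup a i ≡ + rk ⊤ - + rk (lookup S i))
  rankVec≡idx⇔ S a b = mk⇔ (untelescope (+ rk ⊤) (+ rk ⊤) a h rk⊤≡rk⊤-rk⊥)
                           (telescope (+ rk ⊤) (+ rk ⊤) a h rk⊤≡rk⊤-rk⊥)
    where
    h : Fin (suc n) → ℤ
    h j = + rk (lookup (⊥ ∷ S) j)
    rk⊤≡rk⊤-rk⊥ : + rk ⊤ ≡ + rk ⊤ - + rk ⊥
    rk⊤≡rk⊤-rk⊥ rewrite rk-⊥ = sym (ℤ.+-identityʳ _)

  completeChain⇒card : ∀ {X} → IsCompleteChain M X → ∀ j → ∣ lookup X j ∣ ≡ toℕ j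
  completeChain⇒card {X} (X₀≡⊥ , Xₙ≡⊤ , X⊂) =
    strictMono-0-to-m⇒toℕ n (∣_∣ ∘ lookup X) (Subset.p⊂q⇒∣p∣<∣q∣ ∘ X⊂)
      (trans (cong ∣_∣ X₀≡⊥) (Subset.∣⊥∣≡0 n)) (trans (cong ∣_∣ Xₙ≡⊤) (Subset.∣⊤∣≡n n))

  completeChain⇔ : ∀ S →
    IsCompleteChain M (⊥ ∷ S) ⇔ (IsWeakChain M S × (∀ i → ∣ lookup S i ∣ ≡ suc (toℕ i)))
  completeChain⇔ S = mk⇔
    (λ cc@(_ , _ , X⊂) →
      (λ i j i≤j → stepwise⊆⇒mono n (lookup (⊥ ∷ S)) (proj₁ ∘ X⊂) (fsuc i) (fsuc j) (s≤s i≤j)) ,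
      completeChain⇒card {⊥ ∷ S} cc ∘ fsuc)
    (λ (weak , card) → let card′ = ⊥∷-card card in
      refl ,
      Subset.∣p∣≡n⇒p≡⊤ (trans (card′ (fromℕ n)) (Fin.toℕ-fromℕ n)) ,
      λ i → p⊆q∧∣p∣<∣q∣⇒p⊂q (step⊆ weak i)
              (subst₂ _<_ (sym (card′ (inject₁ i))) (sym (card′ (fsuc i)))
                      (s≤s (ℕ.≤-reflexive (Fin.toℕ-inject₁ i)))))
    where
    ⊥∷-card : (∀ i → ∣ lookup S i ∣ ≡ suc (toℕ i)) → ∀ j → ∣ lookup (⊥ ∷ S) j ∣ ≡ toℕ j
    ⊥∷-card card fzero = Subset.∣⊥∣≡0 n
    ⊥∷-card card (fsuc i) = card i
    step⊆ : IsWeakChain M S → ∀ i → lookup (⊥ ∷ S) (inject₁ i) ⊆ lookup (⊥ ∷ S) (fsuc i)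
    step⊆ weak fzero = Subset.⊥⊆
    step⊆ weak (fsuc i) =
      weak (inject₁ i) (fsuc i) (ℕ.≤-trans (ℕ.≤-reflexive (Fin.toℕ-inject₁ i)) (ℕ.n≤1+n _))

  completeChainWithRankVec? : ∀ r → Decidable (λ X → IsCompleteChain M X × rankVec M X ≡ r)
  completeChainWithRankVec? r X = isCompleteChain? M X ×-dec Vec.≡-dec ℤ._≟_ (rankVec M X) r

  completeChainWithRankVec≐weakChainWithMonomial : ∀ a b → InEC M (a , b) →
    (λ S → IsCompleteChain M (⊥ ∷ S) × rankVec M (⊥ ∷ S) ≡ idx M (a , b))
      ≐ (λ S → IsWeakChain M S × HasMonomial M a b S)
  completeChainWithRankVec≐weakChainWithMonomial a b e∈EC =
    (λ {S} (cc , rv) → let (weak , card) = to (completeChain⇔ S) cc in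
      weak , λ i → from (monomial⇔ S i) (to (rankVec≡idx⇔ S a b) rv i , card i)) ,
    (λ {S} (weak , monomial) →
      from (completeChain⇔ S) (weak , λ i → proj₂ (to (monomial⇔ S i) (monomial i))) ,
      from (rankVec≡idx⇔ S a b) (λ i → proj₁ (to (monomial⇔ S i) (monomial i))))
    where
    monomial⇔ : ∀ S i →
      (rk ⊤ ≡ lookup a i + rk (lookup S i) × ∣ lookup S i ∣ ≡ lookup b i + rk (lookup S i))
        ⇔ (+ lookup a i ≡ + rk ⊤ - + rk (lookup S i) × ∣ lookup S i ∣ ≡ suc (toℕ i))
    monomial⇔ S i =
      exponents⇔ {rk ⊤} {lookup a i} {lookup b i} {rk (lookup S i)} {∣ lookup S i ∣} (e∈EC i)

  coeffG∘idx≡c : ∀ e → InEC M e → coeffG M (idx M e) ≡ c M e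
  coeffG∘idx≡c e@(a , b) e∈EC = begin
    coeffG M (idx M e)
      ≡⟨ count-⊥-headed (completeChainWithRankVec? (idx M e)) (proj₁ ∘ proj₁) ⟩
    length (filter (completeChainWithRankVec? (idx M e) ∘ (⊥ ∷_)) (allVecs (allSubsets n) n))
      ≡⟨ cong length (List.filter-≐ _ _ (completeChainWithRankVec≐weakChainWithMonomial a b e∈EC)
                                       (allVecs (allSubsets n) n)) ⟩
    c M e ∎
    where open ≡-Reasoning

  coranks nullities : Vec (Subset n) n → Vec ℕ n
  coranks S = tabulate (λ i → rk ⊤ ∸ rk (lookup S i))
  nullities S = tabulate (λ i → ∣ lookup S i ∣ ∸ rk (lookup S i))

  hasMonomial-coranks-nullities : ∀ S → HasMonomial M (coranks S) (nullities S) S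
  hasMonomial-coranks-nullities S i
    rewrite Vec.lookup∘tabulate (λ i → rk ⊤ ∸ rk (lookup S i)) i
          | Vec.lookup∘tabulate (λ i → ∣ lookup S i ∣ ∸ rk (lookup S i)) i
    = sym (ℕ.m∸n+n≡m (rk-mono Subset.⊆⊤)) , sym (ℕ.m∸n+n≡m (rk-card (lookup S i)))

  completeChain⇒rankVec∈idx[EC] : ∀ X → IsCompleteChain M X →
    Σ (Vec ℕ n × Vec ℕ n) λ e → InEC M e × idx M e ≡ rankVec M X
  completeChain⇒rankVec∈idx[EC] (.⊥ ∷ S) cc@(refl , _) with to (completeChain⇔ S) cc
  ... | weak , card = (coranks S , nullities S) , e∈EC ,
    sym (proj₂ (proj₂ (completeChainWithRankVec≐weakChainWithMonomial
                         (coranks S) (nullities S) e∈EC) (weak , monomial)))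
    where
    monomial : HasMonomial M (coranks S) (nullities S) S
    monomial = hasMonomial-coranks-nullities S
    e∈EC : InEC M (coranks S , nullities S)
    e∈EC i = subst (λ c → + lookup (coranks S) i - + lookup (nullities S) i ≡ + rk ⊤ - + c) (card i)
      (m≡a+k∧c≡b+k⇒a-b≡m-c (lookup (coranks S) i) (lookup (nullities S) i)
                            (proj₁ (monomial i)) (proj₂ (monomial i)))

  idx[EC]⊎coeffG≡0 : ∀ r → (Σ (Vec ℕ n × Vec ℕ n) λ e → InEC M e × idx M e ≡ r) ⊎ coeffG M r ≡ 0
  idx[EC]⊎coeffG≡0 r with any? (completeChainWithRankVec? r) (allVecs (allSubsets n) (suc n))
  ... | no ∄X = inj₂ (cong length (List.filter-none _ (¬Any⇒All¬ _ ∄X)))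
  ... | yes ∃X with satisfied ∃X
  ...   | X , cc , refl = inj₁ (completeChain⇒rankVec∈idx[EC] X cc)

proposition5p29 : ∀ {n : ℕ} (M : Matroid n) →
    IsFormalSumCoeff (coeffG M) (InEC M) (c M) (idx M)
proposition5p29 M r with idx[EC]⊎coeffG≡0 M r
... | inj₁ (e , e∈EC , refl) =
  [ e ] , [] ∷ [] , (e∈EC , refl) ∷ [] ,
  (λ e′ e′∈EC idx≡idx _ → here (idx-injective M e′ e e′∈EC e∈EC idx≡idx)) ,
  trans (coeffG∘idx≡c M e e∈EC) (sym (ℕ.+-identityʳ _))
... | inj₂ coeffG≡0 =
  [] , [] , [] ,
  (λ e e∈EC idx≡r c≢0 → ⊥-elim (c≢0 (begin
    c M e              ≡⟨ coeffG∘idx≡c M e e∈EC ⟨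
    coeffG M (idx M e) ≡⟨ cong (coeffG M) idx≡r ⟩
    coeffG M r         ≡⟨ coeffG≡0 ⟩
    0                  ∎))) ,
  coeffG≡0
  where open ≡-Reasoning
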